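{- Let $q=p^s$ with $p$ prime and $s>1$, let $i$ be a positive integer with $i\mid s$ and $i<s$, and let $f=x^{q-p^i}\in\mathbb{F}_q[x]$. Then $\deg(S_f)\le p^i$.
   Context: $\mathrm{PG}(2,q)$ is the projective plane over $\mathbb{F}_q$. For $f\in\mathbb{F}_q[x]$, $S_f=\{(x,f(x),1):x\in\mathbb{F}_q\}\cup\{(0,1,0)\}$. For a set $D$ of $q+1$ points, $u_i(D)$ is the number of lines of $\mathrm{PG}(2,q)$ containing exactly $i$ points of $D$, and $\deg(D)$ is the largest $i$ with $u_i(D)\neq 0$. -}

module Defs where

open import Level using (0ℓ)
open import Data.Nat using (ℕ; zero; suc; _∸_; _^_; _≤_; _<_)
open import Data.Fin using (Fin)
open import Data.List using (List; []; _∷_; map; concatMap; filter; length; upTo)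
open import Data.Product using (Σ; _×_; _,_)
open import Relation.Binary.PropositionalEquality using (_≡_)
open import Relation.Binary using (DecidableEquality)
open import Relation.Nullary using (¬_; yes; no; Dec)
open import Relation.Nullary.Decidable using (¬?)
open import Algebra.Structures using (IsCommutativeRing)
open import Function.Bundles using (_↔_)

record FiniteField (q : ℕ) : Set₁ where
  field
    Carrier : Set
    _+_ _*_ : Carrier → Carrier → Carrier
    -_ : Carrier → Carrier
    0# 1# : Carrier
    isCommutativeRing : IsCommutativeRing _≡_ _+_ _*_ -_ 0# 1#
    0≢1 : ¬ (0# ≡ 1#)
    inverse : ∀ x → ¬ (x ≡ 0#) → Σ Carrier λ y → x * y ≡ 1#
    _≟_ : DecidableEquality Carrier
    enumeration : Fin q ↔ Carrier

  infixl 7 _*_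
  infixl 6 _+_

  pow : Carrier → ℕ → Carrier
  pow x zero = 1#
  pow x (suc n) = x * pow x n

  elements : List Carrier
  elements = map (Function.Bundles.Inverse.to enumeration) (Data.List.allFin q)
    where import Data.List

  -- homogeneous coordinates of a point / line of PG(2,q)
  Triple : Set
  Triple = Carrier × Carrier × Carrier

  -- canonical representatives of the points of PG(2,q):
  -- (x,y,1), (x,1,0), (1,0,0); one per projective point
  canonical : List Triple
  canonical = concatMap (λ x → map (λ y → (x , y , 1#)) elements) elements
              Data.List.++ map (λ x → (x , 1# , 0#)) elements
              Data.List.++ ((1# , 0# , 0#) ∷ [])
    where import Data.List

  points : List Triple
  points = canonical

  lines : List Triple
  lines = canonical

  Incident : Triple → Triple → Set
  Incident (a , b , c) (x , y , z) = a * x + b * y + c * z ≡ 0#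

  incident? : ∀ L P → Dec (Incident L P)
  incident? (a , b , c) (x , y , z) = (a * x + b * y + c * z) ≟ 0#

  -- number of points of D (a list of distinct points) on the line L
  meet : List Triple → Triple → ℕ
  meet D L = length (filter (incident? L) D)

  u : ℕ → List Triple → ℕ
  u i D = length (filter (λ L → meet D L Data.Nat.≟ i) lines)
    where import Data.Nat

  degBelow : ℕ → List Triple → ℕ
  degBelow zero D = zero
  degBelow (suc n) D with u (suc n) D Data.Nat.≟ 0
    where import Data.Nat
  ... | yes _ = degBelow n D
  ... | no _ = suc n

  -- deg(D): largest i with u_i(D) ≠ 0 (no line meets D in more than |D| points)
  deg : List Triple → ℕ
  deg D = degBelow (length D) D

  S : (Carrier → Carrier) → List Triple
  S f = (0# , 1# , 0#) ∷ map (λ x → (x , f x , 1#)) elements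

-- Write n = p ^ i < q. Since x ^ q = x in a field of order q (compare the products of the
-- nonzero elements before and after scaling by x ≠ 0), f = X ^ (q − n) satisfies f x · xⁿ = x,
-- and x ↦ xⁿ is injective because n ∣ q. A vertical line (through (0,1,0)) meets S_f in at most
-- two points. A line a x + y = 0 through the origin meets it at x = 0 and where a xⁿ = −1, which
-- determines x. Any other line a x + b y + 1 = 0 has b ≠ 0 and misses x = 0; multiplying its
-- equation by xⁿ⁻¹ makes its points roots of the nonzero polynomial b + Xⁿ⁻¹ + a Xⁿ, so there are
-- at most n of them. Hence every line meets S_f in at most n points.

module Submission where

open import Defs
open import Data.Nat using (ℕ; _∸_; _≤_; _<_; _>_)
open import Data.Nat.Divisibility using (_∣_)
open import Data.Nat.Primality using (Prime; prime⇒nonTrivial)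

open import Level using (0ℓ)
open import Data.Nat using (zero; suc; z≤n; s≤s)
import Data.Nat as ℕ
import Data.Nat.Properties as ℕₚ
open import Data.Nat.Divisibility using (divides)
open import Data.Fin as Fin using (Fin)
open import Data.Fin.Properties using (punchInᵢ≢i; nonZeroIndex)
open import Data.List using (List; []; _∷_; _++_; map; filter; length; replicate)
open import Data.List.Properties using (filter-none; filter-reject; length-++; length-replicate)
open import Data.List.Relation.Unary.All as All using (All; []; _∷_)
open import Data.List.Relation.Unary.All.Properties using (all-filter; ++⁺; concat⁺; map⁺)
open import Data.List.Relation.Unary.AllPairs using ([]; _∷_)
open import Data.List.Relation.Unary.Unique.Propositional using (Unique)
import Data.List.Relation.Unary.Unique.Propositional.Properties as Unique
open import Data.Product using (_×_; _,_; proj₁; proj₂)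
open import Data.Sum using (_⊎_; inj₁; inj₂; swap)
open import Function using (_∘_; Injective; Inverse; _↔_; mk↔ₛ′)
open import Function.Construct.Composition using (_↔-∘_)
open import Function.Construct.Symmetry using (↔-sym)
open import Relation.Nullary using (¬_; yes; no; contradiction)
open import Relation.Unary using (Pred; Decidable; _∪_)
open import Relation.Binary.PropositionalEquality using (_≡_; _≢_; refl; sym; trans; cong; cong₂; subst)
open import Relation.Binary.PropositionalEquality using (module ≡-Reasoning)
open import Algebra.Bundles using (CommutativeRing)
open import Algebra.Structures using (IsCommutativeRing)
open import Algebra.Definitions using (AlmostLeftCancellative)

module _ {A : Set} where

  AtMostOne : Pred A 0ℓ → Set
  AtMostOne P = ∀ {x y} → P x → P y → x ≡ y

  length-≤1 : ∀ {P : Pred A 0ℓ} {xs} → AtMostOne P → Unique xs → All P xs → length xs ≤ 1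
  length-≤1 _ [] [] = z≤n
  length-≤1 _ (_ ∷ []) (_ ∷ []) = s≤s z≤n
  length-≤1 P≤1 ((x≢y ∷ _) ∷ _) (px ∷ py ∷ _) = contradiction (P≤1 px py) x≢y

  All-∪-exclude : ∀ {R S : Pred A 0ℓ} {x ys} → AtMostOne R → R x →
                  All (x ≢_) ys → All (R ∪ S) ys → All S ys
  All-∪-exclude {R = R} {S} {x} R≤1 rx x≢ys rss = All.zipWith exclude (x≢ys , rss)
    where
    exclude : ∀ {y} → x ≢ y × (R ∪ S) y → S y
    exclude (x≢y , inj₁ ry) = contradiction (R≤1 rx ry) x≢y
    exclude (_ , inj₂ sy) = sy

  length-≤2 : ∀ {P Q : Pred A 0ℓ} {xs} → AtMostOne P → AtMostOne Q →
              Unique xs → All (P ∪ Q) xs → length xs ≤ 2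
  length-≤2 _ _ [] [] = z≤n
  length-≤2 P≤1 Q≤1 (x≢xs ∷ xs!) (inj₁ px ∷ pqs) =
    s≤s (length-≤1 Q≤1 xs! (All-∪-exclude P≤1 px x≢xs pqs))
  length-≤2 P≤1 Q≤1 (x≢xs ∷ xs!) (inj₂ qx ∷ pqs) =
    s≤s (length-≤1 P≤1 xs! (All-∪-exclude Q≤1 qx x≢xs (All.map swap pqs)))

  module _ {P : Pred A 0ℓ} (P? : Decidable P) where

    length-filter-∷ : ∀ x xs → length (filter P? (x ∷ xs)) ≤ suc (length (filter P? xs))
    length-filter-∷ x xs with P? x
    ... | yes _ = ℕₚ.≤-refl
    ... | no _ = ℕₚ.n≤1+n _

    length-filter-map : ∀ {B : Set} (g : B → A) xs →
                        length (filter P? (map g xs)) ≡ length (filter (P? ∘ g) xs)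
    length-filter-map g [] = refl
    length-filter-map g (x ∷ xs) with P? (g x)
    ... | yes _ = cong suc (length-filter-map g xs)
    ... | no _ = length-filter-map g xs

module _ {q : ℕ} (F : FiniteField q) where

  open FiniteField F
  open IsCommutativeRing isCommutativeRing
    using (+-identityˡ; +-identityʳ; *-identityˡ; *-identityʳ; *-assoc; *-comm; zeroˡ; zeroʳ)

  commutativeRing : CommutativeRing 0ℓ 0ℓ
  commutativeRing = record { isCommutativeRing = isCommutativeRing }

  open CommutativeRing commutativeRing using (commutativeSemiring; semiring; ring; *-commutativeMonoid)
  open import Algebra.Properties.Semiring.Exp semiring using (_^_; ^-homo-*; ^-assocʳ)
  open import Algebra.Properties.Ring ring
    using (+-cancelʳ; [y-z]x≈yx-zx; x∙y⁻¹≈ε⇒x≈y; x≈y⇒x∙y⁻¹≈ε)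
  open import Algebra.Properties.CommutativeMonoid.Sum *-commutativeMonoid
    using (∑-distrib-+; sum-permute; sum-remove; sum-cong-≗; sum-replicate; sum-replicate-zero)
    renaming (sum to ∏)
  open import Algebra.Solver.Ring.NaturalCoefficients.Default commutativeSemiring
    using (solve; _:=_; _:+_; _:*_; con)
  open ≡-Reasoning

  1≢0 : 1# ≢ 0#
  1≢0 = 0≢1 ∘ sym

  xy≡1⇒x[yz]≡z : ∀ {x y} → x * y ≡ 1# → ∀ z → x * (y * z) ≡ z
  xy≡1⇒x[yz]≡z {x} {y} xy≡1 z = begin
    x * (y * z) ≡⟨ *-assoc x y z ⟨
    x * y * z   ≡⟨ cong (_* z) xy≡1 ⟩
    1# * z      ≡⟨ *-identityˡ z ⟩
    z           ∎

  *-almostCancelˡ : AlmostLeftCancellative _≡_ 0# _*_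
  *-almostCancelˡ a x y a≢0 ax≡ay = begin
    x           ≡⟨ undo x ⟨
    b * (a * x) ≡⟨ cong (b *_) ax≡ay ⟩
    b * (a * y) ≡⟨ undo y ⟩
    y           ∎
    where
    b = proj₁ (inverse a a≢0)
    undo = xy≡1⇒x[yz]≡z (trans (*-comm b a) (proj₂ (inverse a a≢0)))

  x≢0∧xy≡0⇒y≡0 : ∀ {x y} → x ≢ 0# → x * y ≡ 0# → y ≡ 0#
  x≢0∧xy≡0⇒y≡0 {x} {y} x≢0 xy≡0 = *-almostCancelˡ x y 0# x≢0 (trans xy≡0 (sym (zeroʳ x)))

  *-≢0 : ∀ {x y} → x ≢ 0# → y ≢ 0# → x * y ≢ 0#
  *-≢0 x≢0 y≢0 = y≢0 ∘ x≢0∧xy≡0⇒y≡0 x≢0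

  x≢y∧xz≡yz⇒z≡0 : ∀ {x y z} → x ≢ y → x * z ≡ y * z → z ≡ 0#
  x≢y∧xz≡yz⇒z≡0 {x} {y} {z} x≢y xz≡yz = x≢0∧xy≡0⇒y≡0 x-y≢0 (begin
    (x + - y) * z       ≡⟨ [y-z]x≈yx-zx z x y ⟩
    x * z + - (y * z)   ≡⟨ x≈y⇒x∙y⁻¹≈ε xz≡yz ⟩
    0#                  ∎)
    where
    x-y≢0 : x + - y ≢ 0#
    x-y≢0 = x≢y ∘ x∙y⁻¹≈ε⇒x≈y x y

  to : Fin q → Carrier
  to = Inverse.to enumeration

  from : Carrier → Fin q
  from = Inverse.from enumeration

  to-from : ∀ y → to (from y) ≡ y
  to-from = Inverse.strictlyInverseˡ enumeration

  to-injective : ∀ {j k} → to j ≡ to k → j ≡ k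
  to-injective {j} {k} e = begin
    j           ≡⟨ Inverse.strictlyInverseʳ enumeration j ⟨
    from (to j) ≡⟨ cong from e ⟩
    from (to k) ≡⟨ Inverse.strictlyInverseʳ enumeration k ⟩
    k           ∎

  ∏-reindex : (σ : Carrier ↔ Carrier) (g : Carrier → Carrier) →
              ∏ (g ∘ to) ≡ ∏ (g ∘ Inverse.to σ ∘ to)
  ∏-reindex σ g = trans (sum-permute (g ∘ to) π) (sum-cong-≗ (cong g ∘ to-from ∘ Inverse.to σ ∘ to))
    where
    π : Fin q ↔ Fin q
    π = ↔-sym enumeration ↔-∘ (σ ↔-∘ enumeration)

  ∏-single : ∀ {n} (t : Fin n → Carrier) i → (∀ j → j ≢ i → t j ≡ 1#) → ∏ t ≡ t i
  ∏-single {suc n} t i others = begin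
    ∏ t                         ≡⟨ sum-remove t ⟩
    t i * ∏ (t ∘ Fin.punchIn i) ≡⟨ cong (t i *_) ∏others≡1 ⟩
    t i * 1#                    ≡⟨ *-identityʳ (t i) ⟩
    t i                         ∎
    where
    ∏others≡1 = trans (sum-cong-≗ (λ j → others _ (punchInᵢ≢i i j))) (sum-replicate-zero n)

  ∏-≢0 : ∀ {n} (t : Fin n → Carrier) → (∀ i → t i ≢ 0#) → ∏ t ≢ 0#
  ∏-≢0 {zero} t _ = 1≢0
  ∏-≢0 {suc n} t t≢0 = *-≢0 (t≢0 Fin.zero) (∏-≢0 (t ∘ Fin.suc) (t≢0 ∘ Fin.suc))

  scaling : ∀ {x} → x ≢ 0# → Carrier ↔ Carrier
  scaling {x} x≢0 =
    mk↔ₛ′ (x *_) (x⁻¹ *_) (xy≡1⇒x[yz]≡z xx⁻¹≡1) (xy≡1⇒x[yz]≡z (trans (*-comm x⁻¹ x) xx⁻¹≡1))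
    where
    x⁻¹ = proj₁ (inverse x x≢0)
    xx⁻¹≡1 = proj₂ (inverse x x≢0)

  unitPart : Carrier → Carrier
  unitPart y with y ≟ 0#
  ... | yes _ = 1#
  ... | no _ = y

  unitPart≢0 : ∀ y → unitPart y ≢ 0#
  unitPart≢0 y with y ≟ 0#
  ... | yes _ = 1≢0
  ... | no y≢0 = y≢0

  0^n≡0 : ∀ n → .{{ℕ.NonZero n}} → 0# ^ n ≡ 0#
  0^n≡0 (suc n) = zeroˡ _

  -- Scaling by x permutes the field and fixes 0, where unitPart is 1 on both sides;
  -- correction supplies the missing factor x there.
  ∏-scale-unitPart : ∀ {x} → x ≢ 0# → ∏ (λ k → x * unitPart (to k)) ≡ ∏ (unitPart ∘ to) * x
  ∏-scale-unitPart {x} x≢0 = begin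
    ∏ (λ k → x * unitPart (to k))
      ≡⟨ sum-cong-≗ (scale-unitPart ∘ to) ⟩
    ∏ (λ k → unitPart (x * to k) * correction (to k))
      ≡⟨ ∑-distrib-+ (unitPart ∘ (x *_) ∘ to) (correction ∘ to) ⟩
    ∏ (unitPart ∘ (x *_) ∘ to) * ∏ (correction ∘ to)
      ≡⟨ cong₂ _*_ (sym (∏-reindex (scaling x≢0) unitPart)) ∏correction≡x ⟩
    ∏ (unitPart ∘ to) * x ∎
    where
    correction : Carrier → Carrier
    correction y with y ≟ 0#
    ... | yes _ = x
    ... | no _ = 1#

    scale-unitPart : ∀ y → x * unitPart y ≡ unitPart (x * y) * correction y
    scale-unitPart y with y ≟ 0# | (x * y) ≟ 0#
    ... | yes _    | yes _    = *-comm x 1#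
    ... | yes refl | no xy≢0  = contradiction (zeroʳ x) xy≢0
    ... | no y≢0   | yes xy≡0 = contradiction xy≡0 (*-≢0 x≢0 y≢0)
    ... | no _     | no _     = sym (*-identityʳ _)

    correction-0 : correction 0# ≡ x
    correction-0 with 0# ≟ 0#
    ... | yes _ = refl
    ... | no 0≢0 = contradiction refl 0≢0

    correction-≢0 : ∀ y → y ≢ 0# → correction y ≡ 1#
    correction-≢0 y y≢0 with y ≟ 0#
    ... | yes y≡0 = contradiction y≡0 y≢0
    ... | no _ = refl

    to≢0 : ∀ {j} → j ≢ from 0# → to j ≢ 0#
    to≢0 j≢ to-j≡0 = j≢ (to-injective (trans to-j≡0 (sym (to-from 0#))))

    ∏correction≡x : ∏ (correction ∘ to) ≡ x
    ∏correction≡x = begin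
      ∏ (correction ∘ to)       ≡⟨ ∏-single _ (from 0#) (λ j → correction-≢0 (to j) ∘ to≢0) ⟩
      correction (to (from 0#)) ≡⟨ cong correction (to-from 0#) ⟩
      correction 0#             ≡⟨ correction-0 ⟩
      x                         ∎

  x^q≡x : ∀ x → x ^ q ≡ x
  x^q≡x x with x ≟ 0#
  ... | yes refl = 0^n≡0 q {{nonZeroIndex (from 0#)}}
  ... | no x≢0 = *-almostCancelˡ A (x ^ q) x (∏-≢0 (unitPart ∘ to) (unitPart≢0 ∘ to)) (begin
    A * x ^ q                     ≡⟨ *-comm A (x ^ q) ⟩
    x ^ q * A                     ≡⟨ cong (_* A) (sum-replicate q) ⟨
    ∏ {q} (λ _ → x) * A           ≡⟨ ∑-distrib-+ (λ _ → x) (unitPart ∘ to) ⟨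
    ∏ (λ k → x * unitPart (to k)) ≡⟨ ∏-scale-unitPart x≢0 ⟩
    A * x                         ∎)
    where
    A = ∏ (unitPart ∘ to)

  ^-injective : ∀ {n} → n ∣ q → Injective _≡_ _≡_ (_^ n)
  ^-injective {n} (divides k q≡kn) {x} {y} xⁿ≡yⁿ = begin
    x           ≡⟨ root x ⟨
    (x ^ n) ^ k ≡⟨ cong (_^ k) xⁿ≡yⁿ ⟩
    (y ^ n) ^ k ≡⟨ root y ⟩
    y           ∎
    where
    root : ∀ z → (z ^ n) ^ k ≡ z
    root z = begin
      (z ^ n) ^ k   ≡⟨ ^-assocʳ z n k ⟩
      z ^ (n ℕ.* k) ≡⟨ cong (z ^_) (trans (ℕₚ.*-comm n k) (sym q≡kn)) ⟩
      z ^ q         ≡⟨ x^q≡x z ⟩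
      z             ∎

  eval : List Carrier → Carrier → Carrier
  eval [] x = 0#
  eval (c ∷ cs) x = c + x * eval cs x

  -- Synthetic division: for every c, divide r cs lists the coefficients of the quotient
  -- of c ∷ cs by X − r.
  divide : Carrier → List Carrier → List Carrier
  divide r [] = []
  divide r (c ∷ cs) = eval (c ∷ cs) r ∷ divide r cs

  length-divide : ∀ r cs → length (divide r cs) ≡ length cs
  length-divide r [] = refl
  length-divide r (c ∷ cs) = cong suc (length-divide r cs)

  -- p(x) − p(r) = (x − r) · quotient(x), with both sides moved so that no subtraction occurs.
  factor : ∀ r c cs x →
           eval (c ∷ cs) x + r * eval (divide r cs) x ≡ x * eval (divide r cs) x + eval (c ∷ cs) r
  factor r c [] x =
    solve 3 (λ r c x → c :+ x :* con 0 :+ r :* con 0 := x :* con 0 :+ (c :+ r :* con 0)) refl r c x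
  factor r c (d ∷ ds) x = begin
    c + x * E x + r * (E r + x * Q)
      ≡⟨ solve 6 (λ r c x Ex Er Q → c :+ x :* Ex :+ r :* (Er :+ x :* Q)
                                 := c :+ r :* Er :+ x :* (Ex :+ r :* Q)) refl r c x (E x) (E r) Q ⟩
    c + r * E r + x * (E x + r * Q)
      ≡⟨ cong (λ w → c + r * E r + x * w) (factor r d ds x) ⟩
    c + r * E r + x * (x * Q + E r)
      ≡⟨ solve 5 (λ r c x Er Q → c :+ r :* Er :+ x :* (x :* Q :+ Er)
                              := x :* (Er :+ x :* Q) :+ (c :+ r :* Er)) refl r c x (E r) Q ⟩
    x * (E r + x * Q) + (c + r * E r) ∎
    where
    E = eval (d ∷ ds)
    Q = eval (divide r ds) x

  divide-root : ∀ {r s} c cs → eval (c ∷ cs) r ≡ 0# → r ≢ s → eval (c ∷ cs) s ≡ 0# →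
                eval (divide r cs) s ≡ 0#
  divide-root {r} {s} c cs r-root r≢s s-root = x≢y∧xz≡yz⇒z≡0 r≢s (begin
    r * Q                   ≡⟨ +-identityˡ (r * Q) ⟨
    0# + r * Q              ≡⟨ cong (_+ r * Q) s-root ⟨
    eval (c ∷ cs) s + r * Q ≡⟨ factor r c cs s ⟩
    s * Q + eval (c ∷ cs) r ≡⟨ cong (s * Q +_) r-root ⟩
    s * Q + 0#              ≡⟨ +-identityʳ (s * Q) ⟩
    s * Q                   ∎)
    where
    Q = eval (divide r cs) s

  c+r0≡c : ∀ c r → c + r * 0# ≡ c
  c+r0≡c c r = trans (cong (c +_) (zeroʳ r)) (+-identityʳ c)

  divide-≡0 : ∀ {r} c cs → eval (c ∷ cs) r ≡ 0# → All (_≡ 0#) (divide r cs) →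
              All (_≡ 0#) (c ∷ cs)
  divide-≡0 {r} c [] root [] = trans (sym (c+r0≡c c r)) root ∷ []
  divide-≡0 {r} c (d ∷ ds) root (e≡0 ∷ rest) =
    trans (sym (c+r0≡c c r)) (subst (λ e → c + r * e ≡ 0#) e≡0 root) ∷ divide-≡0 d ds e≡0 rest

  roots-bound : ∀ cs → ¬ All (_≡ 0#) cs → ∀ {rs} → Unique rs →
                All (λ r → eval cs r ≡ 0#) rs → length rs < length cs
  roots-bound [] cs≢0 _ _ = contradiction [] cs≢0
  roots-bound (c ∷ cs) _ [] [] = s≤s z≤n
  roots-bound (c ∷ cs) cs≢0 {r ∷ rs} (r≢rs ∷ rs!) (r-root ∷ rs-roots) =
    s≤s (subst (length rs <_) (length-divide r cs)
               (roots-bound (divide r cs) (cs≢0 ∘ divide-≡0 c cs r-root) rs! quotient-roots))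
    where
    quotient-roots = All.zipWith (λ (r≢s , s-root) → divide-root c cs r-root r≢s s-root)
                                 (r≢rs , rs-roots)

  eval-replicate : ∀ k cs x → eval (replicate k 0# ++ cs) x ≡ x ^ k * eval cs x
  eval-replicate zero cs x = sym (*-identityˡ _)
  eval-replicate (suc k) cs x = begin
    0# + x * eval (replicate k 0# ++ cs) x ≡⟨ +-identityˡ _ ⟩
    x * eval (replicate k 0# ++ cs) x      ≡⟨ cong (x *_) (eval-replicate k cs x) ⟩
    x * (x ^ k * eval cs x)                ≡⟨ *-assoc x _ _ ⟨
    x * x ^ k * eval cs x                  ∎

  elements-unique : Unique elements
  elements-unique = Unique.map⁺ to-injective (Unique.allFin⁺ q)

  affine : (Carrier → Carrier) → Triple → List Carrier
  affine f L = filter (λ x → incident? L (x , f x , 1#)) elements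

  meet-S≤ : ∀ f L → meet (S f) L ≤ suc (length (affine f L))
  meet-S≤ f L = ℕₚ.≤-trans (length-filter-∷ (incident? L) _ _)
                           (s≤s (ℕₚ.≤-reflexive (length-filter-map (incident? L) _ elements)))

  meet-S≡ : ∀ f L → ¬ Incident L (0# , 1# , 0#) → meet (S f) L ≡ length (affine f L)
  meet-S≡ f L ∞∉L = trans (cong length (filter-reject (incident? L) ∞∉L))
                          (length-filter-map (incident? L) _ elements)

  affine-roots-bound : ∀ f L cs → ¬ All (_≡ 0#) cs →
                       (∀ x → Incident L (x , f x , 1#) → eval cs x ≡ 0#) →
                       length (affine f L) < length cs
  affine-roots-bound f L cs cs≢0 root =
    roots-bound cs cs≢0 (Unique.filter⁺ _ elements-unique)
                (All.map (root _) (all-filter _ elements))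

  meet-vertical : ∀ f a c → ¬ All (_≡ 0#) (c ∷ a ∷ []) → meet (S f) (a , 0# , c) ≤ 2
  meet-vertical f a c ac≢0 =
    ℕₚ.≤-trans (meet-S≤ f _) (affine-roots-bound f _ (c ∷ a ∷ []) ac≢0 linear)
    where
    linear : ∀ x → a * x + 0# * f x + c * 1# ≡ 0# → c + x * (a + x * 0#) ≡ 0#
    linear x = trans (solve 4 (λ a c x y → c :+ x :* (a :+ x :* con 0)
                                        := a :* x :+ con 0 :* y :+ c :* con 1) refl a c x (f x))

  meet-through-origin : ∀ {n} f → (∀ x → f x * x ^ n ≡ x) → Injective _≡_ _≡_ (_^ n) →
                        ∀ a → meet (S f) (a , 1# , 0#) ≤ 2
  meet-through-origin {n} f law ^n-injective a =
    subst (_≤ 2) (sym (meet-S≡ f _ ∞∉L))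
          (length-≤2 (λ x≡0 y≡0 → trans x≡0 (sym y≡0)) Q-atMostOne
                     (Unique.filter⁺ _ elements-unique) (All.map split (all-filter _ elements)))
    where
    ∞∉L : a * 0# + 1# * 1# + 0# * 0# ≢ 0#
    ∞∉L = 1≢0 ∘ trans (solve 1 (λ a → con 1 := a :* con 0 :+ con 1 :* con 1 :+ con 0 :* con 0)
                             refl a)

    Q : Carrier → Set
    Q x = a * x ^ n + 1# ≡ 0#

    Q-atMostOne : AtMostOne Q
    Q-atMostOne {x} qx qy =
      ^n-injective (*-almostCancelˡ a _ _ a≢0 (+-cancelʳ 1# _ _ (trans qx (sym qy))))
      where
      a≢0 : a ≢ 0#
      a≢0 refl = 1≢0 (trans (solve 1 (λ y → con 1 := con 0 :* y :+ con 1) refl (x ^ n)) qx)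

    split : ∀ {x} → a * x + 1# * f x + 0# * 1# ≡ 0# → x ≡ 0# ⊎ Q x
    split {x} on-L with x ≟ 0#
    ... | yes x≡0 = inj₁ x≡0
    ... | no x≢0 = inj₂ (x≢0∧xy≡0⇒y≡0 x≢0 (begin
      x * (a * N + 1#)
        ≡⟨ solve 3 (λ x a N → x :* (a :* N :+ con 1) := a :* x :* N :+ x) refl x a N ⟩
      a * x * N + x
        ≡⟨ cong (a * x * N +_) (law x) ⟨
      a * x * N + f x * N
        ≡⟨ solve 4 (λ a x y N → a :* x :* N :+ y :* N
                             := N :* (a :* x :+ con 1 :* y :+ con 0 :* con 1)) refl a x (f x) N ⟩
      N * (a * x + 1# * f x + 0# * 1#)
        ≡⟨ cong (N *_) on-L ⟩
      N * 0#
        ≡⟨ zeroʳ N ⟩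
      0# ∎))
      where
      N = x ^ n

  meet-nonvertical : ∀ {n} f → 2 ≤ n → f 0# ≡ 0# → (∀ x → f x * x ^ n ≡ x) →
                     ∀ a b → b ≢ 0# → meet (S f) (a , b , 1#) ≤ n
  meet-nonvertical {suc (suc k)} f (s≤s (s≤s z≤n)) f0≡0 law a b b≢0 =
    subst (_≤ suc (suc k)) (sym (meet-S≡ f _ ∞∉L))
          (ℕₚ.≤-pred (subst (length (affine f (a , b , 1#)) <_) length-cs
                            (affine-roots-bound f _ cs (λ { (b≡0 ∷ _) → b≢0 b≡0 }) root)))
    where
    -- b + X^(k+1) + a X^(k+2), whose roots are the x ≠ 0 with a x + b x^(1−n) + 1 = 0
    cs : List Carrier
    cs = b ∷ replicate k 0# ++ 1# ∷ a ∷ []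

    length-cs : length cs ≡ suc (suc (suc k))
    length-cs = cong suc (begin
      length (replicate k 0# ++ 1# ∷ a ∷ []) ≡⟨ length-++ (replicate k 0#) ⟩
      length (replicate k 0#) ℕ.+ 2         ≡⟨ cong (ℕ._+ 2) (length-replicate k) ⟩
      k ℕ.+ 2                               ≡⟨ ℕₚ.+-comm k 2 ⟩
      suc (suc k)                           ∎)

    ∞∉L : a * 0# + b * 1# + 1# * 0# ≢ 0#
    ∞∉L = b≢0 ∘ trans (solve 2 (λ a b → b := a :* con 0 :+ b :* con 1 :+ con 1 :* con 0) refl a b)

    root : ∀ x → a * x + b * f x + 1# * 1# ≡ 0# → eval cs x ≡ 0#
    root x on-L = x≢0∧xy≡0⇒y≡0 x≢0 (begin
      x * eval cs x
        ≡⟨ cong (λ e → x * (b + x * e)) (eval-replicate k _ x) ⟩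
      x * (b + x * (X * (1# + x * (a + x * 0#))))
        ≡⟨ solve 4 (λ x a b X → x :* (b :+ x :* (X :* (con 1 :+ x :* (a :+ x :* con 0))))
                             := x :* (x :* X) :* (a :* x) :+ b :* x :+ x :* (x :* X)) refl x a b X ⟩
      N * (a * x) + b * x + N
        ≡⟨ cong (λ y → N * (a * x) + b * y + N) (law x) ⟨
      N * (a * x) + b * (f x * N) + N
        ≡⟨ solve 5 (λ a b x y N → N :* (a :* x) :+ b :* (y :* N) :+ N
                               := N :* (a :* x :+ b :* y :+ con 1 :* con 1)) refl a b x (f x) N ⟩
      N * (a * x + b * f x + 1# * 1#)
        ≡⟨ cong (N *_) on-L ⟩
      N * 0#
        ≡⟨ zeroʳ N ⟩
      0# ∎)
      where
      X = x ^ k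
      N = x ^ suc (suc k)

      x≢0 : x ≢ 0#
      x≢0 refl = 1≢0 (begin
        1#
          ≡⟨ solve 2 (λ a b → con 1 := a :* con 0 :+ b :* con 0 :+ con 1 :* con 1) refl a b ⟩
        a * 0# + b * 0# + 1# * 1#
          ≡⟨ cong (λ y → a * 0# + b * y + 1# * 1#) f0≡0 ⟨
        a * 0# + b * f 0# + 1# * 1#
          ≡⟨ on-L ⟩
        0# ∎)

  All-lines : ∀ {P : Pred Triple 0ℓ} → (∀ a b → P (a , b , 1#)) → (∀ a → P (a , 1# , 0#)) →
              P (1# , 0# , 0#) → All P lines
  All-lines P-affine P-through-origin P-y-axis =
    ++⁺ (concat⁺ (map⁺ (All.universal (λ a → map⁺ (All.universal (P-affine a) elements)) elements)))
        (++⁺ (map⁺ (All.universal P-through-origin elements)) (P-y-axis ∷ []))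

  deg≤ : ∀ {n} D → All (λ L → meet D L ≤ n) lines → deg D ≤ n
  deg≤ {n} D meet≤n = degBelow≤ (length D)
    where
    degBelow≤ : ∀ m → degBelow m D ≤ n
    degBelow≤ zero = z≤n
    degBelow≤ (suc m) with u (suc m) D ℕ.≟ 0
    ... | yes _ = degBelow≤ m
    ... | no u≢0 with suc m ℕ.≤? n
    ...   | yes m<n = m<n
    ...   | no m≮n = contradiction (cong length (filter-none _ (All.map meet≢suc-m meet≤n))) u≢0
      where
      meet≢suc-m : ∀ {L} → meet D L ≤ n → meet D L ≢ suc m
      meet≢suc-m meet≤ meet≡ = m≮n (subst (_≤ n) meet≡ meet≤)

  deg-S≤ : ∀ {n} f → 2 ≤ n → f 0# ≡ 0# → (∀ x → f x * x ^ n ≡ x) → Injective _≡_ _≡_ (_^ n) →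
           deg (S f) ≤ n
  deg-S≤ {n} f 2≤n f0≡0 law ^n-injective = deg≤ (S f) (All-lines meet-affine through-origin y-axis)
    where
    meet-affine : ∀ a b → meet (S f) (a , b , 1#) ≤ n
    meet-affine a b with b ≟ 0#
    ... | yes refl = ℕₚ.≤-trans (meet-vertical f a 1# (λ { (1≡0 ∷ _) → 1≢0 1≡0 })) 2≤n
    ... | no b≢0 = meet-nonvertical f 2≤n f0≡0 law a b b≢0

    through-origin : ∀ a → meet (S f) (a , 1# , 0#) ≤ n
    through-origin a = ℕₚ.≤-trans (meet-through-origin {n} f law ^n-injective a) 2≤n

    y-axis : meet (S f) (1# , 0# , 0#) ≤ n
    y-axis = ℕₚ.≤-trans (meet-vertical f 1# 0# (λ { (_ ∷ 1≡0 ∷ []) → 1≢0 1≡0 })) 2≤n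

  pow≡^ : ∀ x n → pow x n ≡ x ^ n
  pow≡^ x zero = refl
  pow≡^ x (suc n) = cong (x *_) (pow≡^ x n)

  deg-S-monomial≤ : ∀ {n} → 2 ≤ n → n < q → n ∣ q → deg (S (λ x → pow x (q ∸ n))) ≤ n
  deg-S-monomial≤ {n} 2≤n n<q n∣q = deg-S≤ _ 2≤n f0≡0 law (^-injective n∣q)
    where
    f0≡0 : pow 0# (q ∸ n) ≡ 0#
    f0≡0 = trans (pow≡^ 0# (q ∸ n)) (0^n≡0 (q ∸ n) {{ℕ.>-nonZero (ℕₚ.m<n⇒0<n∸m n<q)}})

    law : ∀ x → pow x (q ∸ n) * x ^ n ≡ x
    law x = begin
      pow x (q ∸ n) * x ^ n ≡⟨ cong (_* x ^ n) (pow≡^ x (q ∸ n)) ⟩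
      x ^ (q ∸ n) * x ^ n   ≡⟨ ^-homo-* x (q ∸ n) n ⟨
      x ^ (q ∸ n ℕ.+ n)     ≡⟨ cong (x ^_) (ℕₚ.m∸n+n≡m (ℕₚ.<⇒≤ n<q)) ⟩
      x ^ q                 ≡⟨ x^q≡x x ⟩
      x                     ∎

open import Data.Nat using (_^_)

corollary3p3 : (p s i : ℕ) → Prime p → s > 1 → i > 0 → i ∣ s → i < s →
    (F : FiniteField (p ^ s)) →
    FiniteField.deg F (FiniteField.S F (λ x → FiniteField.pow F x (p ^ s ∸ p ^ i))) ≤ p ^ i
corollary3p3 p s i p-prime _ i>0 _ i<s F = deg-S-monomial≤ F 2≤pⁱ pⁱ<pˢ pⁱ∣pˢ
  where
  1<p : 1 < p
  1<p = ℕ.nonTrivial⇒n>1 p {{prime⇒nonTrivial p-prime}}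

  2≤pⁱ : 2 ≤ p ^ i
  2≤pⁱ = ℕₚ.^-monoʳ-< p 1<p i>0

  pⁱ<pˢ : p ^ i < p ^ s
  pⁱ<pˢ = ℕₚ.^-monoʳ-< p 1<p i<s

  pⁱ∣pˢ : p ^ i ∣ p ^ s
  pⁱ∣pˢ = divides (p ^ (s ∸ i))
    (trans (cong (p ^_) (sym (ℕₚ.m∸n+n≡m (ℕₚ.<⇒≤ i<s)))) (ℕₚ.^-distribˡ-+-* p (s ∸ i) i))
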